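{- Let $\zeta,\zeta_1,\zeta_2$ be fPCL formulas over $P$ and a De Morgan algebra $K$. Then $\zeta\uplus(\zeta_1\oplus\zeta_2)\equiv(\zeta\uplus\zeta_1)\oplus(\zeta\uplus\zeta_2)$.
   Context: A De Morgan algebra $(K,\vee,\wedge,0,1,\overline{\cdot})$ is a bounded distributive lattice with bottom $0$, top $1$ and a map $k\mapsto\overline k$ with $\overline{\overline k}=k$ and the De Morgan laws. $P$ is a set of ports; a $K$-fuzzy interaction is $\alpha:P\to K$ with $\alpha(p)\ne0$ for some $p$; $fC(P,K)$ is the set of nonempty (finite) sets of $K$-fuzzy interactions. fPIL formulas: $\varphi::=true\mid p\mid\,!\varphi\mid\varphi\sqcup\varphi$ with $\|true\|(\alpha)=1$, $\|p\|(\alpha)=\alpha(p)$, $\|!\varphi\|(\alpha)=\overline{\|\varphi\|(\alpha)}$, $\|\varphi_1\sqcup\varphi_2\|(\alpha)=\|\varphi_1\|(\alpha)\vee\|\varphi_2\|(\alpha)$. fPCL formulas: $\zeta::=\varphi\mid\neg\zeta\mid\zeta\oplus\zeta\mid\zeta\uplus\zeta$; for $\gamma\in fC(P,K)$: $\|\varphi\|(\gamma)=\bigwedge_{\alpha\in\gamma}\|\varphi\|(\alpha)$, $\|\neg\zeta\|(\gamma)=\overline{\|\zeta\|(\gamma)}$, $\|\zeta_1\oplus\zeta_2\|(\gamma)=\|\zeta_1\|(\gamma)\vee\|\zeta_2\|(\gamma)$, $\|\zeta_1\uplus\zeta_2\|(\gamma)=\bigvee_{\gamma_1,\gamma_2\in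 fC(P,K),\,\gamma_1\cup\gamma_2=\gamma}(\|\zeta_1\|(\gamma_1)\wedge\|\zeta_2\|(\gamma_2))$. $\zeta_1\equiv\zeta_2$ means $\|\zeta_1\|(\gamma)=\|\zeta_2\|(\gamma)$ for all $\gamma\in fC(P,K)$, for an arbitrary De Morgan algebra $K$. -}

module Defs where

open import Level using (Level; _⊔_; suc)
open import Algebra.Core using (Op₁; Op₂)
open import Algebra.Lattice.Structures using (IsDistributiveLattice)
open import Relation.Binary.Core using (Rel)
open import Relation.Nullary using (¬_)
open import Data.Product using (Σ; ∃; _×_; _,_)
open import Data.List using (List; []; _∷_; foldr; concatMap)
open import Data.List.NonEmpty using (List⁺; _∷_; toList)

record DeMorganAlgebra (c ℓ : Level) : Set (suc (c ⊔ ℓ)) where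
  infixr 6 _∨_
  infixr 7 _∧_
  infix  4 _≈_
  field
    Carrier : Set c
    _≈_     : Rel Carrier ℓ
    _∨_     : Op₂ Carrier
    _∧_     : Op₂ Carrier
    ‾       : Op₁ Carrier
    𝟘       : Carrier
    𝟙       : Carrier
    isDistributiveLattice : IsDistributiveLattice _≈_ _∨_ _∧_
    ∨-identityʳ : ∀ x → (x ∨ 𝟘) ≈ x
    ∧-identityʳ : ∀ x → (x ∧ 𝟙) ≈ x
    ‾-cong      : ∀ {x y} → x ≈ y → ‾ x ≈ ‾ y
    ‾-involutive : ∀ x → ‾ (‾ x) ≈ x
    deMorgan-∨  : ∀ x y → ‾ (x ∨ y) ≈ (‾ x ∧ ‾ y)
    deMorgan-∧  : ∀ x y → ‾ (x ∧ y) ≈ (‾ x ∨ ‾ y)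

  open IsDistributiveLattice isDistributiveLattice public

module FuzzyPCL {c ℓ : Level} (P : Set) (K : DeMorganAlgebra c ℓ) where

  open DeMorganAlgebra K

  FInteraction : Set (c ⊔ ℓ)
  FInteraction = Σ (P → Carrier) λ α → ∃ λ p → ¬ (α p ≈ 𝟘)

  -- An element of fC(P,K): a nonempty finite set of fuzzy interactions,
  -- represented by a nonempty list enumerating its elements.
  FConfig : Set (c ⊔ ℓ)
  FConfig = List⁺ FInteraction

  data FPIL : Set where
    true : FPIL
    port : P → FPIL
    !_   : FPIL → FPIL
    _⊔ᴵ_ : FPIL → FPIL → FPIL

  data FPCL : Set where
    ⌜_⌝  : FPIL → FPCL
    ¬ᶜ_  : FPCL → FPCL
    _⊕_  : FPCL → FPCL → FPCL
    _⊎_  : FPCL → FPCL → FPCL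

  ⟦_⟧ᴵ : FPIL → FInteraction → Carrier
  ⟦ true ⟧ᴵ α = 𝟙
  ⟦ port p ⟧ᴵ (α , _) = α p
  ⟦ ! φ ⟧ᴵ α = ‾ (⟦ φ ⟧ᴵ α)
  ⟦ φ₁ ⊔ᴵ φ₂ ⟧ᴵ α = ⟦ φ₁ ⟧ᴵ α ∨ ⟦ φ₂ ⟧ᴵ α

  ⋀ : List Carrier → Carrier
  ⋀ = foldr _∧_ 𝟙

  ⋁ : List Carrier → Carrier
  ⋁ = foldr _∨_ 𝟘

  -- All pairs (γ₁, γ₂) of sub-enumerations of γ with γ₁ ∪ γ₂ = γ:
  -- every element goes to γ₁, to γ₂, or to both.
  covers : List FInteraction → List (List FInteraction × List FInteraction)
  covers [] = ([] , []) ∷ []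
  covers (a ∷ as) = concatMap
    (λ { (l , r) → (a ∷ l , r) ∷ (l , a ∷ r) ∷ (a ∷ l , a ∷ r) ∷ [] })
    (covers as)

  -- the value of a pair, contributing only when both parts are nonempty
  -- (i.e. both lie in fC(P,K))
  onNonEmpty : (FConfig → FConfig → Carrier) →
               List FInteraction × List FInteraction → Carrier
  onNonEmpty f ([] , _) = 𝟘
  onNonEmpty f (_ ∷ _ , []) = 𝟘
  onNonEmpty f (x ∷ xs , y ∷ ys) = f (x ∷ xs) (y ∷ ys)

  ⟦_⟧ : FPCL → FConfig → Carrier
  ⟦ ⌜ φ ⌝ ⟧ γ = ⋀ (Data.List.map ⟦ φ ⟧ᴵ (toList γ))
  ⟦ ¬ᶜ ζ ⟧ γ = ‾ (⟦ ζ ⟧ γ)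
  ⟦ ζ₁ ⊕ ζ₂ ⟧ γ = ⟦ ζ₁ ⟧ γ ∨ ⟦ ζ₂ ⟧ γ
  ⟦ ζ₁ ⊎ ζ₂ ⟧ γ =
    ⋁ (Data.List.map (onNonEmpty (λ γ₁ γ₂ → ⟦ ζ₁ ⟧ γ₁ ∧ ⟦ ζ₂ ⟧ γ₂))
                     (covers (toList γ)))

  _≡ᶠ_ : FPCL → FPCL → Set (c ⊔ ℓ)
  ζ₁ ≡ᶠ ζ₂ = ∀ (γ : FConfig) → ⟦ ζ₁ ⟧ γ ≈ ⟦ ζ₂ ⟧ γ

module Submission where

open import Defs
open import Level using (Level)
open import Algebra.Bundles using (CommutativeSemigroup)
import Algebra.Properties.CommutativeSemigroup as CommutativeSemigroupProperties
open import Data.Product using (_,_)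
open import Data.List using ([]; _∷_; map)
open import Data.List.NonEmpty using (toList)

-- A cover (γ₁, γ₂) of γ contributes ⟦ζ⟧ γ₁ ∧ (⟦ζ₁⟧ γ₂ ∨ ⟦ζ₂⟧ γ₂), which distributes
-- into the two contributions to ζ ⊎ ζ₁ and ζ ⊎ ζ₂; joins over the same list of
-- covers then split along ∨.

module CoverProperties {c ℓ : Level} (P : Set) (K : DeMorganAlgebra c ℓ) where
  open DeMorganAlgebra K
  open FuzzyPCL P K

  ∨-commutativeSemigroup : CommutativeSemigroup c ℓ
  ∨-commutativeSemigroup = record
    { _≈_ = _≈_
    ; _∙_ = _∨_
    ; isCommutativeSemigroup = record
      { isSemigroup = record
        { isMagma = record { isEquivalence = isEquivalence ; ∙-cong = ∨-cong }
        ; assoc = ∨-assoc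
        }
      ; comm = ∨-comm
      }
    }

  open CommutativeSemigroupProperties ∨-commutativeSemigroup using (interchange)

  ⋁-map-∨ : ∀ {a} {A : Set a} (h f g : A → Carrier) → (∀ x → h x ≈ f x ∨ g x) →
            ∀ xs → ⋁ (map h xs) ≈ ⋁ (map f xs) ∨ ⋁ (map g xs)
  ⋁-map-∨ h f g h≈f∨g []       = sym (∨-identityʳ 𝟘)
  ⋁-map-∨ h f g h≈f∨g (x ∷ xs) =
    trans (∨-cong (h≈f∨g x) (⋁-map-∨ h f g h≈f∨g xs)) (interchange _ _ _ _)

  onNonEmpty-∨ : (h f g : FConfig → FConfig → Carrier) →
                 (∀ γ₁ γ₂ → h γ₁ γ₂ ≈ f γ₁ γ₂ ∨ g γ₁ γ₂) →
                 ∀ cover → onNonEmpty h cover ≈ onNonEmpty f cover ∨ onNonEmpty g cover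
  onNonEmpty-∨ h f g h≈f∨g ([] , _)        = sym (∨-identityʳ 𝟘)
  onNonEmpty-∨ h f g h≈f∨g (_ ∷ _ , [])    = sym (∨-identityʳ 𝟘)
  onNonEmpty-∨ h f g h≈f∨g (_ ∷ _ , _ ∷ _) = h≈f∨g _ _

mainTheorem7 : ∀ {c ℓ : Level} (P : Set) (K : DeMorganAlgebra c ℓ) →
    let open FuzzyPCL P K in
    ∀ (ζ ζ₁ ζ₂ : FPCL) → (ζ ⊎ (ζ₁ ⊕ ζ₂)) ≡ᶠ ((ζ ⊎ ζ₁) ⊕ (ζ ⊎ ζ₂))
mainTheorem7 P K ζ ζ₁ ζ₂ γ =
  ⋁-map-∨ (onNonEmpty (contribution (ζ₁ ⊕ ζ₂)))
          (onNonEmpty (contribution ζ₁)) (onNonEmpty (contribution ζ₂))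
          (onNonEmpty-∨ _ _ _ (λ γ₁ γ₂ → ∧-distribˡ-∨ (⟦ ζ ⟧ γ₁) _ _))
          (covers (toList γ))
  where
  open DeMorganAlgebra K
  open FuzzyPCL P K
  open CoverProperties P K

  contribution : FPCL → FConfig → FConfig → Carrier
  contribution ζ′ γ₁ γ₂ = ⟦ ζ ⟧ γ₁ ∧ ⟦ ζ′ ⟧ γ₂
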